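{- Let $G$ be a finite group and $H$ a proper subgroup with $[G:H]\geq 3$, and let $G$ act on $G/H$ by left multiplication. There is a one-to-one correspondence between simple rank $3$ $G$-invariant matroids with ground set $G/H$ and nontrivial equivalence relations $\sim$ on $G/H-\{\bar 1\}$ satisfying: (1) for $a,b\in G$, if $\bar a\sim\bar b$ and $\bar a\neq\bar b$, then $\overline{a^{ -1}}\sim\overline{a^{ -1}b}$; (2) for $a,b\in G$ and $h\in H$, if $\bar a\sim\bar b$ then $\overline{ha}\sim\overline{hb}$.
   Context: $G/H$ is the set of left cosets, $\bar a=aH$, $\bar 1=H$. A matroid on $G/H$ is $G$-invariant if $gB$ is a basis for every basis $B$ and $g\in G$. An equivalence relation is nontrivial if it has at least two classes. A matroid is simple if every circuit has at least three elements. -}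

module Defs where

open import Level using (0ℓ)
open import Data.Nat using (ℕ; _≤_)
open import Data.Bool using (Bool; T)
open import Data.Fin using (Fin)
open import Data.Fin.Subset using (Subset; _∈_; _∉_; _⊆_; _⊂_; _∪_; _-_; ⁅_⁆; ∣_∣)
open import Data.Vec using (tabulate; lookup)
open import Data.Product using (Σ; ∃; ∃₂; _×_)
open import Relation.Nullary using (¬_)
open import Relation.Binary.PropositionalEquality using (_≡_; _≢_)
open import Relation.Binary.Bundles using (Setoid)
open import Algebra.Core using (Op₁; Op₂)
open import Algebra.Structures using (IsGroup)
open import Function using (_⇔_)

-- A finite group of order n, with carrier Fin n (every finite group is
-- isomorphic to one of this form).

record FinGroup (n : ℕ) : Set where
  infixl 7 _·_
  field
    _·_     : Op₂ (Fin n)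
    e       : Fin n
    inv     : Op₁ (Fin n)
    isGroup : IsGroup _≡_ _·_ e inv

record IsSubgroup {n : ℕ} (G : FinGroup n) (H : Subset n) : Set where
  open FinGroup G
  field
    e∈H   : e ∈ H
    ·-cl  : ∀ {a b} → a ∈ H → b ∈ H → (a · b) ∈ H
    inv-cl : ∀ {a} → a ∈ H → inv a ∈ H

-- A model of the left coset space G/H: a set Fin m together with the
-- projection π a = aH (so π a ≡ π b iff a⁻¹ b ∈ H, i.e. aH = bH),
-- which is surjective (witnessed by a section s).
record CosetSpace {n : ℕ} (G : FinGroup n) (H : Subset n) (m : ℕ) : Set where
  open FinGroup G
  field
    π       : Fin n → Fin m
    s       : Fin m → Fin n
    π∘s     : ∀ x → π (s x) ≡ x
    π-coset : ∀ a b → (π a ≡ π b) ⇔ (inv a · b ∈ H)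

  one : Fin m
  one = π e

  act : Fin n → Fin m → Fin m
  act g x = π (g · s x)

  image : Fin n → Subset m → Subset m
  image g S = tabulate (λ y → lookup S (act (inv g) y))

-- Matroids on Fin m given by their family of bases (Bool-valued, since
-- the ground set is finite).

module _ {m : ℕ} (B : Subset m → Bool) where

  IsBasis : Subset m → Set
  IsBasis S = T (B S)

  IsMatroid : Set
  IsMatroid =
    (∃ λ S → IsBasis S) ×
    (∀ B₁ B₂ → IsBasis B₁ → IsBasis B₂ → ∀ x → x ∈ B₁ → x ∉ B₂ →
       ∃ λ y → y ∈ B₂ × y ∉ B₁ × IsBasis ((B₁ - x) ∪ ⁅ y ⁆))

  Independent : Subset m → Set
  Independent S = ∃ λ S′ → IsBasis S′ × S ⊆ S′

  IsCircuit : Subset m → Set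
  IsCircuit C = ¬ Independent C × (∀ D → D ⊂ C → Independent D)

  HasRank3 : Set
  HasRank3 = ∀ S → IsBasis S → ∣ S ∣ ≡ 3

  IsSimple : Set
  IsSimple = ∀ C → IsCircuit C → 3 ≤ ∣ C ∣

module _ {n m : ℕ} {G : FinGroup n} {H : Subset n} (Q : CosetSpace G H m) where
  open FinGroup G
  open CosetSpace Q

  IsInvariant : (Subset m → Bool) → Set
  IsInvariant B = ∀ g S → IsBasis B S → IsBasis B (image g S)

  GoodMatroid : (Subset m → Bool) → Set
  GoodMatroid B = IsMatroid B × HasRank3 B × IsSimple B × IsInvariant B

  MatroidSetoid : Setoid 0ℓ 0ℓ
  MatroidSetoid = record
    { Carrier = Σ (Subset m → Bool) GoodMatroid
    ; _≈_ = λ M M′ → ∀ S → Data.Product.proj₁ M S ≡ Data.Product.proj₁ M′ S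
    ; isEquivalence = record
      { refl = λ S → Relation.Binary.PropositionalEquality.refl
      ; sym = λ p S → Relation.Binary.PropositionalEquality.sym (p S)
      ; trans = λ p q S → Relation.Binary.PropositionalEquality.trans (p S) (q S) } }

  Dom : Fin m → Set
  Dom x = x ≢ one

  -- relations on G/H - {1̄}, given as Bool-valued relations on G/H of
  -- which only the values on Dom × Dom matter
  module _ (R : Fin m → Fin m → Bool) where
    _∼_ : Fin m → Fin m → Set
    x ∼ y = T (R x y)

    IsEquivalenceOnDom : Set
    IsEquivalenceOnDom =
      (∀ x → Dom x → x ∼ x) ×
      (∀ x y → Dom x → Dom y → x ∼ y → y ∼ x) ×
      (∀ x y z → Dom x → Dom y → Dom z → x ∼ y → y ∼ z → x ∼ z)

    Nontrivial : Set
    Nontrivial = ∃₂ λ x y → Dom x × Dom y × ¬ (x ∼ y)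

    Cond1 : Set
    Cond1 = ∀ a b → Dom (π a) → Dom (π b) → π a ∼ π b → π a ≢ π b →
            π (inv a) ∼ π (inv a · b)

    Cond2 : Set
    Cond2 = ∀ a b h → h ∈ H → Dom (π a) → Dom (π b) → π a ∼ π b →
            π (h · a) ∼ π (h · b)

    GoodRelation : Set
    GoodRelation = IsEquivalenceOnDom × Nontrivial × Cond1 × Cond2

  RelationSetoid : Setoid 0ℓ 0ℓ
  RelationSetoid = record
    { Carrier = Σ (Fin m → Fin m → Bool) GoodRelation
    ; _≈_ = λ R R′ → ∀ x y → Dom x → Dom y →
              Data.Product.proj₁ R x y ≡ Data.Product.proj₁ R′ x y
    ; isEquivalence = record
      { refl = λ x y _ _ → Relation.Binary.PropositionalEquality.refl
      ; sym = λ p x y dx dy → Relation.Binary.PropositionalEquality.sym (p x y dx dy)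
      ; trans = λ p q x y dx dy → Relation.Binary.PropositionalEquality.trans (p x y dx dy) (q x y dx dy) } }

-- In a simple rank-3 matroid, "x = y or {p, x, y} is not a basis" is an equivalence relation
-- on the points other than p; its classes are the lines through p. For a G-invariant matroid
-- the lines through 1̄ determine all bases, which gives the relation ∼ with p = 1̄; (1) and (2)
-- express its invariance under moving the base point and under the stabiliser H of 1̄.
-- Conversely, from ∼ call a, b, c collinear when the translation taking a to 1̄ takes b and c
-- to related points: (2) makes this independent of the chosen translation and G-invariant,
-- (1) makes it symmetric, and transitivity of ∼ shows that two points determine a line, which
-- gives basis exchange for the non-collinear triples.

{-# OPTIONS --safe #-}
module Submission where

open import Defs
open import Data.Nat using (ℕ; _≤_)
open import Data.Fin.Subset using (Subset)
open import Function.Bundles using (Inverse)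

open import Algebra.Bundles using (Group)
open import Algebra.Structures using (IsGroup)
open import Data.Bool using (Bool; true; false; T)
open import Data.Bool.Properties using (T?)
import Data.Bool.Properties as Bool
open import Data.Empty using (⊥-elim)
open import Data.Fin using (Fin; zero; suc)
open import Data.Fin.Properties using (_≟_; any?)
open import Data.Fin.Subset using (inside; outside; _∈_; _∉_; _⊆_; _─_; _-_; _∪_; ⁅_⁆; ∣_∣)
open import Data.Fin.Subset.Properties
  using ( x∈⁅x⁆; x∈⁅y⁆⇒x≡y; ∣⁅x⁆∣≡1; x∈p∪q⁺; x∈p∪q⁻; x∈p∧x≢y⇒x∈p-y; p─q⊆p; p─⊥≡p
        ; p⊆q⇒∣p∣≤∣q∣; p⊂q⇒∣p∣<∣q∣; ⊆-antisym; nonempty?; Empty-unique; ∣⊥∣≡0; _⊆?_; anySubset?)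
open import Data.Nat using (zero; suc; _<_; s≤s; z≤n)
open import Data.Nat.Properties
  using (_≤?_; ≰⇒>; ≤-trans; ≤-reflexive; ≤-pred; ≤-antisym; <-trans; <⇒≱; suc-injective)
open import Data.Product using (∃; ∃-syntax; _×_; _,_; proj₁; proj₂)
open import Data.Sum using (_⊎_; inj₁; inj₂)
open import Data.Vec using (_∷_; here; there; lookup)
open import Data.Vec.Properties using (≡-dec; []=⇒lookup; lookup⇒[]=; lookup∘tabulate)
open import Function using (_∘_; _⇔_; mk⇔; Equivalence)
open import Level using (0ℓ)
open import Relation.Nullary using (¬_; Dec; yes; no; ¬?; contradiction)
open import Relation.Nullary.Decidable
  using (⌊_⌋; _×-dec_; _⊎-dec_; toWitness; fromWitness; decidable-stable)
open import Relation.Binary.PropositionalEquality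

T-injective : ∀ {u v : Bool} → T u ⇔ T v → u ≡ v
T-injective {false} {false} _   = refl
T-injective {false} {true}  u⇔v = ⊥-elim (Equivalence.from u⇔v _)
T-injective {true}  {false} u⇔v = ⊥-elim (Equivalence.to u⇔v _)
T-injective {true}  {true}  _   = refl

private variable
  n : ℕ
  p q : Subset n
  a b c d x y : Fin n

-- Finite subsets

x∈p─q⇒x∉q : x ∈ p ─ q → x ∉ q
x∈p─q⇒x∉q {x = zero}  {_ ∷ _} {inside ∷ _}  ()
x∈p─q⇒x∉q {x = zero}  {_ ∷ _} {outside ∷ _} _          ()
x∈p─q⇒x∉q {x = suc _} {_ ∷ _} {_ ∷ _}       (there x∈) (there x∈q) = x∈p─q⇒x∉q x∈ x∈q

x∈p-y⁻ : x ∈ p - y → x ∈ p × x ≢ y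
x∈p-y⁻ {x = x} {p = p} {y = y} x∈ = p─q⊆p p ⁅ y ⁆ x∈ , λ { refl → x∈p─q⇒x∉q x∈ (x∈⁅x⁆ x) }

∣p∣≡1+∣p-x∣ : x ∈ p → ∣ p ∣ ≡ suc ∣ p - x ∣
∣p∣≡1+∣p-x∣ {p = inside ∷ p}  here        = cong (suc ∘ ∣_∣) (sym (p─⊥≡p p))
∣p∣≡1+∣p-x∣ {p = inside ∷ _}  (there x∈p) = cong suc (∣p∣≡1+∣p-x∣ x∈p)
∣p∣≡1+∣p-x∣ {p = outside ∷ _} (there x∈p) = ∣p∣≡1+∣p-x∣ x∈p

∣p∣≡0⇒x∉p : ∣ p ∣ ≡ 0 → x ∉ p
∣p∣≡0⇒x∉p ∣p∣≡0 x∈p with () ← trans (sym (∣p∣≡1+∣p-x∣ x∈p)) ∣p∣≡0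

pick : ∀ {n k} (p : Subset n) → ∣ p ∣ ≡ suc k → ∃[ x ] x ∈ p × ∣ p - x ∣ ≡ k
pick {n} p ∣p∣≡1+k with nonempty? p
... | yes (x , x∈p) = x , x∈p , suc-injective (trans (sym (∣p∣≡1+∣p-x∣ x∈p)) ∣p∣≡1+k)
... | no ¬nonempty with () ← trans (sym ∣p∣≡1+k) (trans (cong ∣_∣ (Empty-unique ¬nonempty)) (∣⊥∣≡0 n))

p-x⊆q⇒p⊆⁅x⁆∪q : p - x ⊆ q → p ⊆ ⁅ x ⁆ ∪ q
p-x⊆q⇒p⊆⁅x⁆∪q {x = x} p-x⊆q {y} y∈p with y ≟ x
... | yes refl = x∈p∪q⁺ (inj₁ (x∈⁅x⁆ x))
... | no y≢x   = x∈p∪q⁺ (inj₂ (p-x⊆q (x∈p∧x≢y⇒x∈p-y y∈p y≢x)))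

∣p-x∣≡0⇒p⊆⁅x⁆ : ∣ p - x ∣ ≡ 0 → p ⊆ ⁅ x ⁆
∣p-x∣≡0⇒p⊆⁅x⁆ {x = x} ∣p-x∣≡0 {y} y∈p with y ≟ x
... | yes refl = x∈⁅x⁆ x
... | no y≢x   = contradiction (x∈p∧x≢y⇒x∈p-y y∈p y≢x) (∣p∣≡0⇒x∉p ∣p-x∣≡0)

∣⁅x⁆∪p∣≤1+∣p∣ : (x : Fin n) (p : Subset n) → ∣ ⁅ x ⁆ ∪ p ∣ ≤ suc ∣ p ∣
∣⁅x⁆∪p∣≤1+∣p∣ x p =
  ≤-trans (≤-reflexive (∣p∣≡1+∣p-x∣ (x∈p∪q⁺ (inj₁ (x∈⁅x⁆ x))))) (s≤s (p⊆q⇒∣p∣≤∣q∣ rest⊆p))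
  where
  rest⊆p : (⁅ x ⁆ ∪ p) - x ⊆ p
  rest⊆p y∈ with x∈p-y⁻ y∈
  ... | y∈∪ , y≢x with x∈p∪q⁻ ⁅ x ⁆ p y∈∪
  ... | inj₁ y∈⁅x⁆ = contradiction (x∈⁅y⁆⇒x≡y x y∈⁅x⁆) y≢x
  ... | inj₂ y∈p   = y∈p

-- d is returned only when p is empty.
∣p∣≤2⇒⊆pair : {p : Subset n} → Fin n → ∣ p ∣ ≤ 2 → ∃[ a ] ∃[ b ] p ⊆ ⁅ a ⁆ ∪ ⁅ b ⁆
∣p∣≤2⇒⊆pair {p = p} d ∣p∣≤2 with ∣ p ∣ in ∣p∣≡
... | 0 = d , d , λ x∈p → contradiction x∈p (∣p∣≡0⇒x∉p ∣p∣≡)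
... | 1 with pick p ∣p∣≡
...   | a , _ , ∣p-a∣≡0 = a , a , x∈p∪q⁺ ∘ inj₁ ∘ ∣p-x∣≡0⇒p⊆⁅x⁆ ∣p-a∣≡0
∣p∣≤2⇒⊆pair {p = p} d ∣p∣≤2 | 2 with pick p ∣p∣≡
...   | a , _ , ∣p-a∣≡1 with pick (p - a) ∣p-a∣≡1
...     | b , _ , ∣p-a-b∣≡0 = a , b , p-x⊆q⇒p⊆⁅x⁆∪q (∣p-x∣≡0⇒p⊆⁅x⁆ ∣p-a-b∣≡0)
∣p∣≤2⇒⊆pair d (s≤s (s≤s ())) | suc (suc (suc _))

pair⊆ : a ∈ p → b ∈ p → ⁅ a ⁆ ∪ ⁅ b ⁆ ⊆ p
pair⊆ {a = a} {b = b} a∈p b∈p x∈ with x∈p∪q⁻ ⁅ a ⁆ ⁅ b ⁆ x∈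
... | inj₁ x∈⁅a⁆ rewrite x∈⁅y⁆⇒x≡y a x∈⁅a⁆ = a∈p
... | inj₂ x∈⁅b⁆ rewrite x∈⁅y⁆⇒x≡y b x∈⁅b⁆ = b∈p

triple : Fin n → Fin n → Fin n → Subset n
triple a b c = ⁅ a ⁆ ∪ ⁅ b ⁆ ∪ ⁅ c ⁆

data OneOf {A : Set} (a b c : A) : A → Set where
  first  : OneOf a b c a
  second : OneOf a b c b
  third  : OneOf a b c c

OneOf-map : ∀ {A B : Set} (f : A → B) {a b c x : A} → OneOf a b c x → OneOf (f a) (f b) (f c) (f x)
OneOf-map f first  = first
OneOf-map f second = second
OneOf-map f third  = third

OneOf-swap₁₂ : ∀ {A : Set} {a b c x : A} → OneOf a b c x → OneOf b a c x
OneOf-swap₁₂ first  = second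
OneOf-swap₁₂ second = first
OneOf-swap₁₂ third  = third

OneOf-rotate : ∀ {A : Set} {a b c x : A} → OneOf a b c x → OneOf c a b x
OneOf-rotate first  = second
OneOf-rotate second = third
OneOf-rotate third  = first

triple-cong : ∀ {a′ b′ c′ : Fin n} → a ≡ a′ → b ≡ b′ → c ≡ c′ → triple a b c ≡ triple a′ b′ c′
triple-cong refl refl refl = refl

∈-triple⁻ : x ∈ triple a b c → OneOf a b c x
∈-triple⁻ {a = a} {b} {c} x∈ with x∈p∪q⁻ ⁅ a ⁆ (⁅ b ⁆ ∪ ⁅ c ⁆) x∈
... | inj₁ x∈⁅a⁆ rewrite x∈⁅y⁆⇒x≡y a x∈⁅a⁆ = first
... | inj₂ x∈bc with x∈p∪q⁻ ⁅ b ⁆ ⁅ c ⁆ x∈bc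
...   | inj₁ x∈⁅b⁆ rewrite x∈⁅y⁆⇒x≡y b x∈⁅b⁆ = second
...   | inj₂ x∈⁅c⁆ rewrite x∈⁅y⁆⇒x≡y c x∈⁅c⁆ = third

∈-triple⁺ : OneOf a b c x → x ∈ triple a b c
∈-triple⁺ {a = a} first  = x∈p∪q⁺ (inj₁ (x∈⁅x⁆ a))
∈-triple⁺ {b = b} second = x∈p∪q⁺ (inj₂ (x∈p∪q⁺ (inj₁ (x∈⁅x⁆ b))))
∈-triple⁺ {c = c} third  = x∈p∪q⁺ (inj₂ (x∈p∪q⁺ (inj₂ (x∈⁅x⁆ c))))

triple⊆ : a ∈ p → b ∈ p → c ∈ p → triple a b c ⊆ p
triple⊆ a∈p b∈p c∈p x∈ with ∈-triple⁻ x∈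
... | first  = a∈p
... | second = b∈p
... | third  = c∈p

triple-≡ : ∀ {a′ b′ c′ : Fin n} →
  OneOf a′ b′ c′ a → OneOf a′ b′ c′ b → OneOf a′ b′ c′ c →
  OneOf a b c a′ → OneOf a b c b′ → OneOf a b c c′ →
  triple a b c ≡ triple a′ b′ c′
triple-≡ a b c a′ b′ c′ = ⊆-antisym
  (triple⊆ (∈-triple⁺ a) (∈-triple⁺ b) (∈-triple⁺ c))
  (triple⊆ (∈-triple⁺ a′) (∈-triple⁺ b′) (∈-triple⁺ c′))

triple-swap₁₂ : triple a b c ≡ triple b a c
triple-swap₁₂ = triple-≡ second first third second first third

triple-swap₂₃ : triple a b c ≡ triple a c b
triple-swap₂₃ = triple-≡ first third second first third second

triple-rotate : triple a b c ≡ triple b c a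
triple-rotate = triple-≡ third first second second third first

triple-exchange : ∀ {a b c d : Fin n} → a ≢ c → b ≢ c → (triple a b c - c) ∪ ⁅ d ⁆ ≡ triple a b d
triple-exchange {a = a} {b} {c} {d} a≢c b≢c =
  ⊆-antisym ⊆triple
    (triple⊆ (left (∈-triple⁺ first) a≢c) (left (∈-triple⁺ second) b≢c) (x∈p∪q⁺ (inj₂ (x∈⁅x⁆ d))))
  where
  ⊆triple : (triple a b c - c) ∪ ⁅ d ⁆ ⊆ triple a b d
  ⊆triple x∈ with x∈p∪q⁻ (triple a b c - c) ⁅ d ⁆ x∈
  ... | inj₂ x∈⁅d⁆ rewrite x∈⁅y⁆⇒x≡y d x∈⁅d⁆ = ∈-triple⁺ third
  ... | inj₁ x∈abc-c with x∈p-y⁻ x∈abc-c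
  ...   | x∈abc , x≢c with ∈-triple⁻ x∈abc
  ...     | first  = ∈-triple⁺ first
  ...     | second = ∈-triple⁺ second
  ...     | third  = contradiction refl x≢c
  left : x ∈ triple a b c → x ≢ c → x ∈ (triple a b c - c) ∪ ⁅ d ⁆
  left x∈ x≢c = x∈p∪q⁺ (inj₁ (x∈p∧x≢y⇒x∈p-y x∈ x≢c))

∣pair∣≤2 : (a b : Fin n) → ∣ ⁅ a ⁆ ∪ ⁅ b ⁆ ∣ ≤ 2
∣pair∣≤2 a b = ≤-trans (∣⁅x⁆∪p∣≤1+∣p∣ a ⁅ b ⁆) (s≤s (≤-reflexive (∣⁅x⁆∣≡1 b)))

∣triple∣≤3 : (a b c : Fin n) → ∣ triple a b c ∣ ≤ 3
∣triple∣≤3 a b c = ≤-trans (∣⁅x⁆∪p∣≤1+∣p∣ a (⁅ b ⁆ ∪ ⁅ c ⁆)) (s≤s (∣pair∣≤2 b c))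

3≤∣p∣ : ∀ {p : Subset n} {a b c} → a ∈ p → b ∈ p → c ∈ p → a ≢ b → a ≢ c → b ≢ c → 3 ≤ ∣ p ∣
3≤∣p∣ a∈p b∈p c∈p a≢b a≢c b≢c
  rewrite ∣p∣≡1+∣p-x∣ a∈p
        | ∣p∣≡1+∣p-x∣ (x∈p∧x≢y⇒x∈p-y b∈p (a≢b ∘ sym))
        | ∣p∣≡1+∣p-x∣ (x∈p∧x≢y⇒x∈p-y (x∈p∧x≢y⇒x∈p-y c∈p (a≢c ∘ sym)) (b≢c ∘ sym))
  = s≤s (s≤s (s≤s z≤n))

∣triple∣≡3 : a ≢ b → a ≢ c → b ≢ c → ∣ triple a b c ∣ ≡ 3
∣triple∣≡3 {a = a} {b} {c} a≢b a≢c b≢c =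
  ≤-antisym (∣triple∣≤3 a b c)
            (3≤∣p∣ (∈-triple⁺ first) (∈-triple⁺ second) (∈-triple⁺ third) a≢b a≢c b≢c)

∣p∣≡3⇒p≡triple-through : ∀ {p : Subset n} {a b} → ∣ p ∣ ≡ 3 → a ∈ p → b ∈ p → a ≢ b →
                         ∃[ c ] a ≢ c × b ≢ c × p ≡ triple a b c
∣p∣≡3⇒p≡triple-through {p = p} {a} {b} ∣p∣≡3 a∈p b∈p a≢b with pick (p - a - b) ∣p-a-b∣≡1
  where
  ∣p-a-b∣≡1 : ∣ p - a - b ∣ ≡ 1
  ∣p-a-b∣≡1 = suc-injective (suc-injective (begin
    suc (suc ∣ p - a - b ∣) ≡⟨ cong suc (∣p∣≡1+∣p-x∣ (x∈p∧x≢y⇒x∈p-y b∈p (a≢b ∘ sym))) ⟨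
    suc ∣ p - a ∣           ≡⟨ ∣p∣≡1+∣p-x∣ a∈p ⟨
    ∣ p ∣                   ≡⟨ ∣p∣≡3 ⟩
    3                       ∎))
    where open ≡-Reasoning
... | c , c∈p-a-b , ∣p-a-b-c∣≡0 with x∈p-y⁻ c∈p-a-b
...   | c∈p-a , c≢b with x∈p-y⁻ c∈p-a
...     | c∈p , c≢a = c , c≢a ∘ sym , c≢b ∘ sym , ⊆-antisym p⊆abc (triple⊆ a∈p b∈p c∈p)
  where
  p⊆abc : p ⊆ triple a b c
  p⊆abc = p-x⊆q⇒p⊆⁅x⁆∪q (p-x⊆q⇒p⊆⁅x⁆∪q (∣p-x∣≡0⇒p⊆⁅x⁆ ∣p-a-b-c∣≡0))

∣p∣≡3⇒p≡triple : (p : Subset n) → ∣ p ∣ ≡ 3 →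
                 ∃[ a ] ∃[ b ] ∃[ c ] a ≢ b × a ≢ c × b ≢ c × p ≡ triple a b c
∣p∣≡3⇒p≡triple p ∣p∣≡3 with pick p ∣p∣≡3
... | a , a∈p , ∣p-a∣≡2 with pick (p - a) ∣p-a∣≡2
...   | b , b∈p-a , _ with x∈p-y⁻ b∈p-a
...     | b∈p , b≢a with ∣p∣≡3⇒p≡triple-through ∣p∣≡3 a∈p b∈p (b≢a ∘ sym)
...       | c , a≢c , b≢c , p≡abc = a , b , c , b≢a ∘ sym , a≢c , b≢c , p≡abc

-- Matroids of rank 3

module _ {n : ℕ} (B : Subset n → Bool) where

  independent? : ∀ S → Dec (Independent B S)
  independent? S = anySubset? λ S′ → T? (B S′) ×-dec S ⊆? S′

  ∣S∣<3⇒independent : IsSimple B → ∀ S → ∣ S ∣ < 3 → Independent B S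
  ∣S∣<3⇒independent simple S ∣S∣<3 = go 3 S ∣S∣<3 ∣S∣<3
    where
    go : ∀ k S → ∣ S ∣ < k → ∣ S ∣ < 3 → Independent B S
    go (suc k) S ∣S∣<1+k ∣S∣<3 = decidable-stable (independent? S) λ dependent →
      <⇒≱ ∣S∣<3 (simple S (dependent , λ D D⊂S →
        let ∣D∣<∣S∣ = p⊂q⇒∣p∣<∣q∣ D⊂S in
        go k D (≤-trans ∣D∣<∣S∣ (≤-pred ∣S∣<1+k)) (<-trans ∣D∣<∣S∣ ∣S∣<3)))

  -- Extend {p, y} to a basis {p, y, w} and exchange w against {p, x, z}: the new basis is
  -- {p, y, x} or {p, y, z}.
  ¬basis-trans : IsMatroid B → HasRank3 B → IsSimple B → ∀ {p x y z : Fin n} → y ≢ p →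
                 ¬ IsBasis B (triple p x y) → ¬ IsBasis B (triple p y z) → ¬ IsBasis B (triple p x z)
  ¬basis-trans matroid rank3 simple {p} {x} {y} {z} y≢p ¬pxy ¬pyz pxz
    with ∣S∣<3⇒independent simple (⁅ p ⁆ ∪ ⁅ y ⁆) (s≤s (∣pair∣≤2 p y))
  ... | S , S-basis , py⊆S
    with ∣p∣≡3⇒p≡triple-through (rank3 S S-basis)
           (py⊆S (x∈p∪q⁺ (inj₁ (x∈⁅x⁆ p)))) (py⊆S (x∈p∪q⁺ (inj₂ (x∈⁅x⁆ y)))) (y≢p ∘ sym)
  ... | w , p≢w , y≢w , refl with w ≟ x | w ≟ z
  ...   | yes refl | _        = ¬pxy (subst (IsBasis B) triple-swap₂₃ S-basis)
  ...   | no _     | yes refl = ¬pyz S-basis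
  ...   | no w≢x   | no w≢z
    with proj₂ matroid (triple p y w) (triple p x z) S-basis pxz w (∈-triple⁺ third) w∉pxz
    where
    w∉pxz : w ∉ triple p x z
    w∉pxz w∈ with ∈-triple⁻ w∈
    ... | first  = p≢w refl
    ... | second = w≢x refl
    ... | third  = w≢z refl
  ... | t , t∈pxz , t∉S , basis′
    with ∈-triple⁻ t∈pxz | subst (IsBasis B) (triple-exchange p≢w y≢w) basis′
  ...   | first  | _   = t∉S (∈-triple⁺ first)
  ...   | second | pyx = ¬pxy (subst (IsBasis B) triple-swap₂₃ pyx)
  ...   | third  | pyz = ¬pyz pyz

-- The action of G on G/H

module _ {n : ℕ} {G : FinGroup n} {H : Subset n} (subgroup : IsSubgroup G H)
         {m : ℕ} (Q : CosetSpace G H m) where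

  open FinGroup G
  open IsGroup isGroup using (assoc; identityˡ; identityʳ; inverseˡ; inverseʳ)
  open IsSubgroup subgroup
  open CosetSpace Q

  group : Group 0ℓ 0ℓ
  group = record { isGroup = isGroup }

  open import Algebra.Properties.Group group
    using (⁻¹-anti-homo-∙; ⁻¹-anti-homo-\\; ε⁻¹≈ε; \\-leftDividesˡ; \\-leftDividesʳ; //-rightDividesʳ)
  open ≡-Reasoning

  π-≡ : ∀ {a b} → inv a · b ∈ H → π a ≡ π b
  π-≡ {a} {b} = Equivalence.from (π-coset a b)

  π-≡⁻ : ∀ {a b} → π a ≡ π b → inv a · b ∈ H
  π-≡⁻ {a} {b} = Equivalence.to (π-coset a b)

  act-π : ∀ g a → act g (π a) ≡ π (g · a)
  act-π g a = sym (π-≡ (subst (_∈ H) (sym cancel) (π-≡⁻ (sym (π∘s (π a))))))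
    where
    cancel : inv (g · a) · (g · s (π a)) ≡ inv a · s (π a)
    cancel = begin
      inv (g · a) · (g · s (π a))      ≡⟨ cong (_· (g · s (π a))) (⁻¹-anti-homo-∙ g a) ⟩
      (inv a · inv g) · (g · s (π a))  ≡⟨ assoc (inv a) (inv g) _ ⟩
      inv a · (inv g · (g · s (π a)))  ≡⟨ cong (inv a ·_) (\\-leftDividesʳ g _) ⟩
      inv a · s (π a)                  ∎

  act-∙ : ∀ g h x → act g (act h x) ≡ act (g · h) x
  act-∙ g h x = trans (act-π g (h · s x)) (cong π (sym (assoc g h (s x))))

  act-e : ∀ x → act e x ≡ x
  act-e x = trans (cong π (identityˡ (s x))) (π∘s x)

  act-inv-act : ∀ g x → act (inv g) (act g x) ≡ x
  act-inv-act g x = begin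
    act (inv g) (act g x)  ≡⟨ act-∙ (inv g) g x ⟩
    act (inv g · g) x      ≡⟨ cong (λ k → act k x) (inverseˡ g) ⟩
    act e x                ≡⟨ act-e x ⟩
    x                      ∎

  act-act-inv : ∀ g x → act g (act (inv g) x) ≡ x
  act-act-inv g x = begin
    act g (act (inv g) x)  ≡⟨ act-∙ g (inv g) x ⟩
    act (g · inv g) x      ≡⟨ cong (λ k → act k x) (inverseʳ g) ⟩
    act e x                ≡⟨ act-e x ⟩
    x                      ∎

  act-injective : ∀ g {x y} → act g x ≡ act g y → x ≡ y
  act-injective g {x} {y} gx≡gy = begin
    x                      ≡⟨ act-inv-act g x ⟨
    act (inv g) (act g x)  ≡⟨ cong (act (inv g)) gx≡gy ⟩
    act (inv g) (act g y)  ≡⟨ act-inv-act g y ⟩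
    y                      ∎

  act-one : ∀ g → act g one ≡ π g
  act-one g = trans (act-π g e) (cong π (identityʳ g))

  act-H-one : ∀ {h} → h ∈ H → act h one ≡ one
  act-H-one {h} h∈H =
    trans (act-one h) (sym (π-≡ (subst (_∈ H) (sym (trans (cong (_· h) ε⁻¹≈ε) (identityˡ h))) h∈H)))

  act-H-≢one : ∀ {h} → h ∈ H → x ≢ one → act h x ≢ one
  act-H-≢one {h = h} h∈H x≢one hx≡one =
    x≢one (act-injective h (trans hx≡one (sym (act-H-one h∈H))))

  shift : Fin m → Fin m → Fin m
  shift a = act (inv (s a))

  shift-self : ∀ a → shift a a ≡ one
  shift-self a = cong π (inverseˡ (s a))

  shift-≢one : ∀ {a b} → a ≢ b → shift a b ≢ one
  shift-≢one {a} a≢b ab≡one =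
    a≢b (sym (act-injective (inv (s a)) (trans ab≡one (sym (shift-self a)))))

  inv-s-one∈H : inv (s one) ∈ H
  inv-s-one∈H = inv-cl (subst (_∈ H) (trans (cong (_· s one) ε⁻¹≈ε) (identityˡ (s one)))
                                     (π-≡⁻ (sym (π∘s one))))

  -- h relates the two representatives s (g a) and g · s a of the coset g a.
  shift-act : ∀ g a → ∃[ h ] h ∈ H × ∀ x → shift (act g a) (act g x) ≡ act h (shift a x)
  shift-act g a = h , π-≡⁻ (π∘s (act g a)) , λ x → begin
    act (inv s′) (act g x)     ≡⟨ act-∙ (inv s′) g x ⟩
    act (inv s′ · g) x         ≡⟨ cong (λ u → act u x) h·s[a]⁻¹≡s′⁻¹·g ⟨
    act (h · inv (s a)) x      ≡⟨ act-∙ h (inv (s a)) x ⟨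
    act h (act (inv (s a)) x)  ∎
    where
    s′ : Fin n
    s′ = s (act g a)
    h : Fin n
    h = inv s′ · (g · s a)
    h·s[a]⁻¹≡s′⁻¹·g : h · inv (s a) ≡ inv s′ · g
    h·s[a]⁻¹≡s′⁻¹·g =
      trans (assoc (inv s′) (g · s a) (inv (s a))) (cong (inv s′ ·_) (//-rightDividesʳ (s a) g))

  ∈-image⁻ : ∀ {g S x} → x ∈ image g S → act (inv g) x ∈ S
  ∈-image⁻ {g} {S} {x} x∈ =
    lookup⇒[]= _ S (trans (sym (lookup∘tabulate (λ y → lookup S (act (inv g) y)) x)) ([]=⇒lookup x∈))

  ∈-image⁺ : ∀ {g S x} → act (inv g) x ∈ S → x ∈ image g S
  ∈-image⁺ {g} {S} {x} x∈ =
    lookup⇒[]= x _ (trans (lookup∘tabulate (λ y → lookup S (act (inv g) y)) x) ([]=⇒lookup x∈))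

  image-triple : ∀ g a b c → image g (triple a b c) ≡ triple (act g a) (act g b) (act g c)
  image-triple g a b c = ⊆-antisym ⊆triple (triple⊆ (moved first) (moved second) (moved third))
    where
    moved : ∀ {x} → OneOf a b c x → act g x ∈ image g (triple a b c)
    moved {x} o = ∈-image⁺ (subst (_∈ triple a b c) (sym (act-inv-act g x)) (∈-triple⁺ o))
    ⊆triple : image g (triple a b c) ⊆ triple (act g a) (act g b) (act g c)
    ⊆triple {x} x∈ = subst (_∈ triple (act g a) (act g b) (act g c)) (act-act-inv g x)
                           (∈-triple⁺ (OneOf-map (act g) (∈-triple⁻ (∈-image⁻ x∈))))

  module _ {B : Subset m → Bool} (invariant : IsInvariant Q B) where

    basis-act : ∀ g {a b c} → IsBasis B (triple a b c) →
                IsBasis B (triple (act g a) (act g b) (act g c))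
    basis-act g {a} {b} {c} = subst (IsBasis B) (image-triple g a b c) ∘ invariant g (triple a b c)

    basis⇔basis-at-one : ∀ {a b c} →
      IsBasis B (triple a b c) ⇔ IsBasis B (triple one (shift a b) (shift a c))
    basis⇔basis-at-one {a} {b} {c} = mk⇔
      (subst (IsBasis B) (triple-cong (shift-self a) refl refl) ∘ basis-act (inv (s a)))
      (subst (IsBasis B) (triple-cong (trans (act-one (s a)) (π∘s a)) (act-act-inv (s a) b)
                                      (act-act-inv (s a) c))
       ∘ basis-act (s a))

  relationOf : (Subset m → Bool) → Fin m → Fin m → Bool
  relationOf B x y = ⌊ x ≟ y ⊎-dec ¬? (T? (B (triple one x y))) ⌋

  relationOf⁻ : ∀ B {x y} → T (relationOf B x y) → x ≡ y ⊎ ¬ IsBasis B (triple one x y)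
  relationOf⁻ B {x} {y} = toWitness {a? = x ≟ y ⊎-dec ¬? (T? (B (triple one x y)))}

  relationOf⁺ : ∀ B {x y} → x ≡ y ⊎ ¬ IsBasis B (triple one x y) → T (relationOf B x y)
  relationOf⁺ B {x} {y} = fromWitness {a? = x ≟ y ⊎-dec ¬? (T? (B (triple one x y)))}

  relationOf-cong : ∀ {B B′ : Subset m → Bool} → (∀ S → B S ≡ B′ S) →
                    ∀ x y → relationOf B x y ≡ relationOf B′ x y
  relationOf-cong B≗B′ x y = cong (λ b → ⌊ x ≟ y ⊎-dec ¬? (T? b) ⌋) (B≗B′ (triple one x y))

  -- From relations to matroids

  module _ (R : Fin m → Fin m → Bool) where

    data Collinear (a b c : Fin m) : Set where
      coincide₁₂ : a ≡ b → Collinear a b c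
      coincide₁₃ : a ≡ c → Collinear a b c
      coincide₂₃ : b ≡ c → Collinear a b c
      related    : T (R (shift a b) (shift a c)) → Collinear a b c

    related-if-apart : ∀ {a b c} → (a ≢ b → a ≢ c → T (R (shift a b) (shift a c))) → Collinear a b c
    related-if-apart {a} {b} {c} r with a ≟ b | a ≟ c
    ... | yes a≡b | _       = coincide₁₂ a≡b
    ... | no _    | yes a≡c = coincide₁₃ a≡c
    ... | no a≢b  | no a≢c  = related (r a≢b a≢c)

    collinear? : ∀ a b c → Dec (Collinear a b c)
    collinear? a b c with a ≟ b | a ≟ c | b ≟ c | T? (R (shift a b) (shift a c))
    ... | yes a≡b | _       | _       | _     = yes (coincide₁₂ a≡b)
    ... | no _    | yes a≡c | _       | _     = yes (coincide₁₃ a≡c)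
    ... | no _    | no _    | yes b≡c | _     = yes (coincide₂₃ b≡c)
    ... | no _    | no _    | no _    | yes r = yes (related r)
    ... | no a≢b  | no a≢c  | no b≢c  | no ¬r = no λ where
      (coincide₁₂ a≡b) → a≢b a≡b
      (coincide₁₃ a≡c) → a≢c a≡c
      (coincide₂₃ b≡c) → b≢c b≡c
      (related r)      → ¬r r

    Triangle : Subset m → Set
    Triangle S = ∃[ a ] ∃[ b ] ∃[ c ] S ≡ triple a b c × ¬ Collinear a b c

    triangle? : ∀ S → Dec (Triangle S)
    triangle? S = any? λ a → any? λ b → any? λ c →
      ≡-dec Bool._≟_ S (triple a b c) ×-dec ¬? (collinear? a b c)

    matroidOf : Subset m → Bool
    matroidOf S = ⌊ triangle? S ⌋

    triangle⇒basis : ∀ {S} → Triangle S → IsBasis matroidOf S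
    triangle⇒basis {S} = fromWitness {a? = triangle? S}

    basis⇒triangle : ∀ {S} → IsBasis matroidOf S → Triangle S
    basis⇒triangle {S} = toWitness {a? = triangle? S}

  triangle-transfer : ∀ {R R′ : Fin m → Fin m → Bool} →
                      (∀ x y → x ≢ one → y ≢ one → R′ x y ≡ R x y) →
                      ∀ {S} → Triangle R S → Triangle R′ S
  triangle-transfer {R} {R′} R′≗R (a , b , c , S≡abc , ¬abc) = a , b , c , S≡abc , ¬abc ∘ back
    where
    back : Collinear R′ a b c → Collinear R a b c
    back (coincide₁₂ a≡b) = coincide₁₂ a≡b
    back (coincide₁₃ a≡c) = coincide₁₃ a≡c
    back (coincide₂₃ b≡c) = coincide₂₃ b≡c
    back (related r)      =
      related (subst T (R′≗R _ _ (shift-≢one (¬abc ∘ coincide₁₂)) (shift-≢one (¬abc ∘ coincide₁₃)))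
                       r)

  matroidOf-cong : ∀ {R R′ : Fin m → Fin m → Bool} →
                   (∀ x y → x ≢ one → y ≢ one → R x y ≡ R′ x y) →
                   ∀ S → matroidOf R S ≡ matroidOf R′ S
  matroidOf-cong {R} {R′} R≗R′ S = T-injective (mk⇔
    (triangle⇒basis R′ ∘ triangle-transfer R′≗R ∘ basis⇒triangle R)
    (triangle⇒basis R ∘ triangle-transfer R≗R′ ∘ basis⇒triangle R′))
    where
    R′≗R : ∀ x y → x ≢ one → y ≢ one → R′ x y ≡ R x y
    R′≗R x y x≢one y≢one = sym (R≗R′ x y x≢one y≢one)

  module _ (R : Fin m → Fin m → Bool) (good : GoodRelation Q R) where

    private
      ∼-refl : ∀ x → x ≢ one → T (R x x)
      ∼-refl = proj₁ (proj₁ good)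

      ∼-sym : ∀ x y → x ≢ one → y ≢ one → T (R x y) → T (R y x)
      ∼-sym = proj₁ (proj₂ (proj₁ good))

      ∼-trans : ∀ x y z → x ≢ one → y ≢ one → z ≢ one → T (R x y) → T (R y z) → T (R x z)
      ∼-trans = proj₂ (proj₂ (proj₁ good))

      nontrivial : Nontrivial Q R
      nontrivial = proj₁ (proj₂ good)

      cond1 : Cond1 Q R
      cond1 = proj₁ (proj₂ (proj₂ good))

      cond2 : Cond2 Q R
      cond2 = proj₂ (proj₂ (proj₂ good))

    ∼-act : ∀ {h x y} → h ∈ H → x ≢ one → y ≢ one → T (R x y) → T (R (act h x) (act h y))
    ∼-act {h} {x} {y} h∈H x≢one y≢one r =
      cond2 (s x) (s y) h h∈H
            (subst (_≢ one) (sym (π∘s x)) x≢one) (subst (_≢ one) (sym (π∘s y)) y≢one)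
            (subst₂ (λ u v → T (R u v)) (sym (π∘s x)) (sym (π∘s y)) r)

    ∼-act⁻ : ∀ {h x y} → h ∈ H → x ≢ one → y ≢ one → T (R (act h x) (act h y)) → T (R x y)
    ∼-act⁻ {h} {x} {y} h∈H x≢one y≢one r =
      subst₂ (λ u v → T (R u v)) (act-inv-act h x) (act-inv-act h y)
        (∼-act (inv-cl h∈H) (act-H-≢one h∈H x≢one) (act-H-≢one h∈H y≢one) r)

    -- Condition (1), with the base point moved from a to b.
    ∼-rebase : ∀ {a b c} → a ≢ b → a ≢ c → b ≢ c →
               T (R (shift a b) (shift a c)) → T (R (shift b a) (shift b c))
    ∼-rebase {a} {b} {c} a≢b a≢c b≢c r =
      subst₂ (λ u v → T (R (π u) (π v))) inv-b′≡ inv-b′·c′≡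
        (cond1 b′ c′ (shift-≢one a≢b) (shift-≢one a≢c) r (b≢c ∘ act-injective (inv (s a))))
      where
      b′ c′ : Fin n
      b′ = inv (s a) · s b
      c′ = inv (s a) · s c
      inv-b′≡ : inv b′ ≡ inv (s b) · s a
      inv-b′≡ = ⁻¹-anti-homo-\\ (s a) (s b)
      inv-b′·c′≡ : inv b′ · c′ ≡ inv (s b) · s c
      inv-b′·c′≡ = begin
        inv b′ · c′                            ≡⟨ cong (_· c′) inv-b′≡ ⟩
        (inv (s b) · s a) · (inv (s a) · s c)  ≡⟨ assoc (inv (s b)) (s a) c′ ⟩
        inv (s b) · (s a · (inv (s a) · s c))  ≡⟨ cong (inv (s b) ·_) (\\-leftDividesˡ (s a) (s c)) ⟩
        inv (s b) · s c                        ∎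

    collinear-swap₂₃ : Collinear R a b c → Collinear R a c b
    collinear-swap₂₃ (coincide₁₂ a≡b) = coincide₁₃ a≡b
    collinear-swap₂₃ (coincide₁₃ a≡c) = coincide₁₂ a≡c
    collinear-swap₂₃ (coincide₂₃ b≡c) = coincide₂₃ (sym b≡c)
    collinear-swap₂₃ (related r)      = related-if-apart R λ a≢c a≢b →
      ∼-sym _ _ (shift-≢one a≢b) (shift-≢one a≢c) r

    collinear-swap₁₂ : Collinear R a b c → Collinear R b a c
    collinear-swap₁₂ (coincide₁₂ a≡b) = coincide₁₂ (sym a≡b)
    collinear-swap₁₂ (coincide₁₃ a≡c) = coincide₂₃ a≡c
    collinear-swap₁₂ (coincide₂₃ b≡c) = coincide₁₃ b≡c
    collinear-swap₁₂ {a = a} {c = c} (related r) with a ≟ c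
    ... | yes a≡c = coincide₂₃ a≡c
    ... | no a≢c  = related-if-apart R λ b≢a b≢c → ∼-rebase (b≢a ∘ sym) a≢c b≢c r

    collinear-from₁ : ∀ {b′ c′} → Collinear R a b c →
                      OneOf a b c b′ → OneOf a b c c′ → Collinear R a b′ c′
    collinear-from₁ _   first  _      = coincide₁₂ refl
    collinear-from₁ _   _      first  = coincide₁₃ refl
    collinear-from₁ _   second second = coincide₂₃ refl
    collinear-from₁ abc second third  = abc
    collinear-from₁ abc third  second = collinear-swap₂₃ abc
    collinear-from₁ _   third  third  = coincide₂₃ refl

    collinear-among : ∀ {a′ b′ c′} → Collinear R a b c →
                      OneOf a b c a′ → OneOf a b c b′ → OneOf a b c c′ → Collinear R a′ b′ c′
    collinear-among abc first  b′ c′ = collinear-from₁ abc b′ c′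
    collinear-among abc second b′ c′ =
      collinear-from₁ (collinear-swap₁₂ abc) (OneOf-swap₁₂ b′) (OneOf-swap₁₂ c′)
    collinear-among abc third  b′ c′ =
      collinear-from₁ (collinear-swap₁₂ (collinear-swap₂₃ abc)) (OneOf-rotate b′) (OneOf-rotate c′)

    collinear-triple : ∀ {a b c a′ b′ c′} → triple a b c ≡ triple a′ b′ c′ →
                       Collinear R a b c → Collinear R a′ b′ c′
    collinear-triple {a} {b} {c} {a′} {b′} {c′} abc≡ abc =
      collinear-among abc (oneOf first) (oneOf second) (oneOf third)
      where
      oneOf : ∀ {x} → OneOf a′ b′ c′ x → OneOf a b c x
      oneOf {x} o = ∈-triple⁻ (subst (x ∈_) (sym abc≡) (∈-triple⁺ o))

    collinear-act : ∀ g {a b c} → Collinear R a b c → Collinear R (act g a) (act g b) (act g c)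
    collinear-act g (coincide₁₂ a≡b) = coincide₁₂ (cong (act g) a≡b)
    collinear-act g (coincide₁₃ a≡c) = coincide₁₃ (cong (act g) a≡c)
    collinear-act g (coincide₂₃ b≡c) = coincide₂₃ (cong (act g) b≡c)
    collinear-act g {a} {b} {c} (related r) = related-if-apart R λ ga≢gb ga≢gc →
      let h , h∈H , shift≡ = shift-act g a in
      subst₂ (λ u v → T (R u v)) (sym (shift≡ b)) (sym (shift≡ c))
        (∼-act h∈H (shift-≢one (ga≢gb ∘ cong (act g))) (shift-≢one (ga≢gc ∘ cong (act g))) r)

    collinear-act⁻ : ∀ g {a b c} → Collinear R (act g a) (act g b) (act g c) → Collinear R a b c
    collinear-act⁻ g {a} {b} {c} gagbgc with collinear-act (inv g) gagbgc
    ... | abc rewrite act-inv-act g a | act-inv-act g b | act-inv-act g c = abc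

    collinear-one⁺ : x ≢ one → y ≢ one → T (R x y) → Collinear R one x y
    collinear-one⁺ x≢one y≢one = related ∘ ∼-act inv-s-one∈H x≢one y≢one

    collinear-one⁻ : x ≢ one → y ≢ one → Collinear R one x y → T (R x y)
    collinear-one⁻ x≢one _     (coincide₁₂ one≡x) = contradiction (sym one≡x) x≢one
    collinear-one⁻ _     y≢one (coincide₁₃ one≡y) = contradiction (sym one≡y) y≢one
    collinear-one⁻ x≢one _     (coincide₂₃ refl)  = ∼-refl _ x≢one
    collinear-one⁻ x≢one y≢one (related r)        = ∼-act⁻ inv-s-one∈H x≢one y≢one r

    collinear-line : a ≢ b → Collinear R a b c → Collinear R a b d → Collinear R a c d
    collinear-line a≢b (coincide₁₂ a≡b) _                = contradiction a≡b a≢b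
    collinear-line a≢b _                (coincide₁₂ a≡b) = contradiction a≡b a≢b
    collinear-line _   (coincide₁₃ a≡c) _                = coincide₁₂ a≡c
    collinear-line _   _                (coincide₁₃ a≡d) = coincide₁₃ a≡d
    collinear-line _   (coincide₂₃ refl) abd             = abd
    collinear-line _   abc              (coincide₂₃ refl) = collinear-swap₂₃ abc
    collinear-line a≢b (related r₁)     (related r₂)     = related-if-apart R λ a≢c a≢d →
      ∼-trans _ _ _ (shift-≢one a≢c) (shift-≢one a≢b) (shift-≢one a≢d)
        (∼-sym _ _ (shift-≢one a≢b) (shift-≢one a≢c) r₁) r₂

    collinear-on-line : ∀ {a b x y z} → a ≢ b →
                        Collinear R a b x → Collinear R a b y → Collinear R a b z → Collinear R x y z
    collinear-on-line {a} {x = x} a≢b abx aby abz with x ≟ a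
    ... | yes refl = collinear-line a≢b aby abz
    ... | no x≢a   = collinear-line x≢a (collinear-swap₁₂ (collinear-line a≢b abx aby))
                                        (collinear-swap₁₂ (collinear-line a≢b abx abz))

    triangle-image : ∀ g {S} → Triangle R S → Triangle R (image g S)
    triangle-image g (a , b , c , refl , ¬abc) =
      act g a , act g b , act g c , image-triple g a b c , ¬abc ∘ collinear-act⁻ g

    triangle-at-one : x ≢ one → y ≢ one → ¬ T (R x y) → Triangle R (triple one x y)
    triangle-at-one x≢one y≢one ¬xy = one , _ , _ , refl , ¬xy ∘ collinear-one⁻ x≢one y≢one

    -- As ∼ has two classes, x is unrelated to u or to v.
    triangle-through-one : ∀ x → ∃[ S ] Triangle R S × one ∈ S × x ∈ S
    triangle-through-one x with x ≟ one | nontrivial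
    ... | yes refl   | u , v , u≢one , v≢one , ¬uv =
      triple one u v , triangle-at-one u≢one v≢one ¬uv , ∈-triple⁺ first , ∈-triple⁺ first
    ... | no x≢one | u , v , u≢one , v≢one , ¬uv with T? (R x u)
    ...   | no ¬xu =
      triple one x u , triangle-at-one x≢one u≢one ¬xu , ∈-triple⁺ first , ∈-triple⁺ second
    ...   | yes xu =
      triple one x v , triangle-at-one x≢one v≢one ¬xv , ∈-triple⁺ first , ∈-triple⁺ second
      where
      ¬xv : ¬ T (R x v)
      ¬xv = ¬uv ∘ ∼-trans _ _ _ u≢one x≢one v≢one (∼-sym _ _ x≢one u≢one xu)

    triangle-through : ∀ x y → ∃[ S ] Triangle R S × x ∈ S × y ∈ S
    triangle-through x y with triangle-through-one (shift x y)
    ... | S , xyz , one∈S , y∈S =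
      image (s x) S , triangle-image (s x) xyz ,
      ∈-image⁺ (subst (_∈ S) (sym (shift-self x)) one∈S) , ∈-image⁺ y∈S

    triangle-rotate : ∀ {S x} → Triangle R S → x ∈ S →
                      ∃[ a ] ∃[ b ] S ≡ triple a b x × ¬ Collinear R a b x
    triangle-rotate (a , b , c , refl , ¬abc) x∈S with ∈-triple⁻ x∈S
    ... | first  = b , c , triple-rotate , λ bca → ¬abc (collinear-among bca third first second)
    ... | second = a , c , triple-swap₂₃ , λ acb → ¬abc (collinear-among acb first third second)
    ... | third  = a , b , refl , ¬abc

    triangle-replace : ∀ {a b x y S′} → ¬ Collinear R a b x → x ∉ S′ → y ∈ S′ → ¬ Collinear R a b y →
                       y ∉ triple a b x × Triangle R ((triple a b x - x) ∪ ⁅ y ⁆)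
    triangle-replace {a} {b} {x} {y} ¬abx x∉S′ y∈S′ ¬aby =
      y∉abx , a , b , y , triple-exchange (¬abx ∘ coincide₁₃) (¬abx ∘ coincide₂₃) , ¬aby
      where
      y∉abx : y ∉ triple a b x
      y∉abx y∈ with ∈-triple⁻ y∈
      ... | first  = ¬aby (coincide₁₃ refl)
      ... | second = ¬aby (coincide₂₃ refl)
      ... | third  = x∉S′ y∈S′

    triangle-exchange-last : ∀ {a b x S′} → ¬ Collinear R a b x → x ∉ S′ → Triangle R S′ →
      ∃[ y ] y ∈ S′ × y ∉ triple a b x × Triangle R ((triple a b x - x) ∪ ⁅ y ⁆)
    triangle-exchange-last {a} {b} {x} ¬abx x∉S′ (y₁ , y₂ , y₃ , refl , ¬y₁y₂y₃)
      with collinear? R a b y₁ | collinear? R a b y₂ | collinear? R a b y₃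
    ... | no ¬aby₁ | _        | _        = y₁ , y₁∈ , triangle-replace ¬abx x∉S′ y₁∈ ¬aby₁
      where y₁∈ = ∈-triple⁺ first
    ... | yes _    | no ¬aby₂ | _        = y₂ , y₂∈ , triangle-replace ¬abx x∉S′ y₂∈ ¬aby₂
      where y₂∈ = ∈-triple⁺ second
    ... | yes _    | yes _    | no ¬aby₃ = y₃ , y₃∈ , triangle-replace ¬abx x∉S′ y₃∈ ¬aby₃
      where y₃∈ = ∈-triple⁺ third
    ... | yes aby₁ | yes aby₂ | yes aby₃ =
      contradiction (collinear-on-line (¬abx ∘ coincide₁₂) aby₁ aby₂ aby₃) ¬y₁y₂y₃

    matroidOf-isMatroid : IsMatroid (matroidOf R)
    matroidOf-isMatroid = has-basis nontrivial , exchange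
      where
      has-basis : Nontrivial Q R → ∃ λ S → IsBasis (matroidOf R) S
      has-basis (u , v , u≢one , v≢one , ¬uv) =
        triple one u v , triangle⇒basis R (triangle-at-one u≢one v≢one ¬uv)
      exchange : ∀ B₁ B₂ → IsBasis (matroidOf R) B₁ → IsBasis (matroidOf R) B₂ →
                 ∀ x → x ∈ B₁ → x ∉ B₂ → ∃ λ y → y ∈ B₂ × y ∉ B₁ × IsBasis (matroidOf R) ((B₁ - x) ∪ ⁅ y ⁆)
      exchange B₁ B₂ b₁ b₂ x x∈B₁ x∉B₂ with triangle-rotate (basis⇒triangle R b₁) x∈B₁
      ... | a , b , refl , ¬abx with triangle-exchange-last ¬abx x∉B₂ (basis⇒triangle R b₂)
      ...   | y , y∈B₂ , y∉B₁ , t = y , y∈B₂ , y∉B₁ , triangle⇒basis R t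

    matroidOf-rank3 : HasRank3 (matroidOf R)
    matroidOf-rank3 S b with basis⇒triangle R b
    ... | a , b , c , refl , ¬abc =
      ∣triple∣≡3 (¬abc ∘ coincide₁₂) (¬abc ∘ coincide₁₃) (¬abc ∘ coincide₂₃)

    matroidOf-simple : IsSimple (matroidOf R)
    matroidOf-simple C (dependent , _) = decidable-stable (3 ≤? ∣ C ∣) λ 3≰∣C∣ →
      let a , b , C⊆ab = ∣p∣≤2⇒⊆pair one (≤-pred (≰⇒> 3≰∣C∣))
          S , abc , a∈S , b∈S = triangle-through a b
      in dependent (S , triangle⇒basis R abc , λ x∈C → pair⊆ a∈S b∈S (C⊆ab x∈C))

    matroidOf-invariant : IsInvariant Q (matroidOf R)
    matroidOf-invariant g S = triangle⇒basis R ∘ triangle-image g ∘ basis⇒triangle R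

    matroidOf-good : GoodMatroid Q (matroidOf R)
    matroidOf-good = matroidOf-isMatroid , matroidOf-rank3 , matroidOf-simple , matroidOf-invariant

    relationOf-matroidOf : ∀ x y → x ≢ one → y ≢ one → relationOf (matroidOf R) x y ≡ R x y
    relationOf-matroidOf x y x≢one y≢one = T-injective (mk⇔ to from)
      where
      to : T (relationOf (matroidOf R) x y) → T (R x y)
      to xy with relationOf⁻ (matroidOf R) xy
      ... | inj₁ refl   = ∼-refl x x≢one
      ... | inj₂ ¬basis =
        decidable-stable (T? (R x y)) (¬basis ∘ triangle⇒basis R ∘ triangle-at-one x≢one y≢one)
      from : T (R x y) → T (relationOf (matroidOf R) x y)
      from xy = relationOf⁺ (matroidOf R) (inj₂ λ basis →
        let a , b , c , one-x-y≡abc , ¬abc = basis⇒triangle R basis in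
        ¬abc (collinear-triple one-x-y≡abc (collinear-one⁺ x≢one y≢one xy)))

  -- From matroids to relations

  module _ (B : Subset m → Bool) (good : GoodMatroid Q B) where

    private
      matroid   = proj₁ good
      rank3     = proj₁ (proj₂ good)
      simple    = proj₁ (proj₂ (proj₂ good))
      invariant = proj₂ (proj₂ (proj₂ good))

    ¬collinear⇒basis : ∀ {a b c} → ¬ Collinear (relationOf B) a b c → IsBasis B (triple a b c)
    ¬collinear⇒basis {a} {b} {c} ¬abc = Equivalence.from (basis⇔basis-at-one invariant)
      (decidable-stable (T? (B (triple one (shift a b) (shift a c))))
        (¬abc ∘ related ∘ relationOf⁺ B ∘ inj₂))

    basis⇒¬collinear : ∀ {a b c} → a ≢ b → a ≢ c → b ≢ c →
                       IsBasis B (triple a b c) → ¬ Collinear (relationOf B) a b c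
    basis⇒¬collinear a≢b _ _ _ (coincide₁₂ a≡b) = a≢b a≡b
    basis⇒¬collinear _ a≢c _ _ (coincide₁₃ a≡c) = a≢c a≡c
    basis⇒¬collinear _ _ b≢c _ (coincide₂₃ b≡c) = b≢c b≡c
    basis⇒¬collinear {a} _ _ b≢c abc (related r) with relationOf⁻ B r
    ... | inj₁ ab≡ac  = b≢c (act-injective (inv (s a)) ab≡ac)
    ... | inj₂ ¬basis = ¬basis (Equivalence.to (basis⇔basis-at-one invariant) abc)

    relationOf-isEquivalence : IsEquivalenceOnDom Q (relationOf B)
    relationOf-isEquivalence = ∼-refl , ∼-sym , ∼-trans
      where
      ∼-refl : ∀ x → x ≢ one → T (relationOf B x x)
      ∼-refl _ _ = relationOf⁺ B (inj₁ refl)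
      ∼-sym : ∀ x y → x ≢ one → y ≢ one → T (relationOf B x y) → T (relationOf B y x)
      ∼-sym _ _ _ _ xy with relationOf⁻ B xy
      ... | inj₁ x≡y    = relationOf⁺ B (inj₁ (sym x≡y))
      ... | inj₂ ¬basis = relationOf⁺ B (inj₂ (¬basis ∘ subst (IsBasis B) triple-swap₂₃))
      ∼-trans : ∀ x y z → x ≢ one → y ≢ one → z ≢ one →
                T (relationOf B x y) → T (relationOf B y z) → T (relationOf B x z)
      ∼-trans _ _ _ _ y≢one _ xy yz with relationOf⁻ B xy | relationOf⁻ B yz
      ... | inj₁ refl | _         = yz
      ... | inj₂ _    | inj₁ refl = xy
      ... | inj₂ ¬xy  | inj₂ ¬yz  =
        relationOf⁺ B (inj₂ (¬basis-trans B matroid rank3 simple y≢one ¬xy ¬yz))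

    relationOf-nontrivial : Nontrivial Q (relationOf B)
    relationOf-nontrivial with proj₁ matroid
    ... | S , S-basis with ∣p∣≡3⇒p≡triple S (rank3 S S-basis)
    ...   | a , b , c , a≢b , a≢c , b≢c , refl =
      shift a b , shift a c , shift-≢one a≢b , shift-≢one a≢c ,
      basis⇒¬collinear a≢b a≢c b≢c S-basis ∘ related

    relationOf-cond1 : Cond1 Q (relationOf B)
    relationOf-cond1 a b _ _ r πa≢πb with relationOf⁻ B r
    ... | inj₁ πa≡πb  = contradiction πa≡πb πa≢πb
    ... | inj₂ ¬basis = relationOf⁺ B (inj₂ (¬basis ∘ subst (IsBasis B) moved ∘ basis-act invariant a))
      where
      moved : triple (act a one) (act a (π (inv a))) (act a (π (inv a · b))) ≡ triple one (π a) (π b)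
      moved = trans (triple-cong (act-one a) (trans (act-π a (inv a)) (cong π (inverseʳ a)))
                                 (trans (act-π a (inv a · b)) (cong π (\\-leftDividesˡ a b))))
                    triple-swap₁₂

    relationOf-cond2 : Cond2 Q (relationOf B)
    relationOf-cond2 a b h h∈H _ _ r with relationOf⁻ B r
    ... | inj₁ πa≡πb  =
      relationOf⁺ B (inj₁ (trans (sym (act-π h a)) (trans (cong (act h) πa≡πb) (act-π h b))))
    ... | inj₂ ¬basis =
      relationOf⁺ B (inj₂ (¬basis ∘ subst (IsBasis B) moved ∘ basis-act invariant (inv h)))
      where
      cancel : ∀ a → act (inv h) (π (h · a)) ≡ π a
      cancel a = trans (act-π (inv h) (h · a)) (cong π (\\-leftDividesʳ h a))
      moved : triple (act (inv h) one) (act (inv h) (π (h · a))) (act (inv h) (π (h · b))) ≡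
              triple one (π a) (π b)
      moved = triple-cong (act-H-one (inv-cl h∈H)) (cancel a) (cancel b)

    relationOf-good : GoodRelation Q (relationOf B)
    relationOf-good =
      relationOf-isEquivalence , relationOf-nontrivial , relationOf-cond1 , relationOf-cond2

    matroidOf-relationOf : ∀ S → matroidOf (relationOf B) S ≡ B S
    matroidOf-relationOf S = T-injective (mk⇔ to from)
      where
      to : IsBasis (matroidOf (relationOf B)) S → IsBasis B S
      to basis = let a , b , c , S≡abc , ¬abc = basis⇒triangle (relationOf B) basis in
        subst (IsBasis B) (sym S≡abc) (¬collinear⇒basis ¬abc)
      from : IsBasis B S → IsBasis (matroidOf (relationOf B)) S
      from basis = let a , b , c , a≢b , a≢c , b≢c , S≡abc = ∣p∣≡3⇒p≡triple S (rank3 S basis) in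
        triangle⇒basis (relationOf B)
          (a , b , c , S≡abc , basis⇒¬collinear a≢b a≢c b≢c (subst (IsBasis B) S≡abc basis))

  matroids↔relations : Inverse (MatroidSetoid Q) (RelationSetoid Q)
  matroids↔relations = record
    { to        = λ (B , good) → relationOf B , relationOf-good B good
    ; from      = λ (R , good) → matroidOf R , matroidOf-good R good
    ; to-cong   = λ B≈B′ x y _ _ → relationOf-cong B≈B′ x y
    ; from-cong = matroidOf-cong
    ; inverse   =
        (λ {R} B≈ x y x≢one y≢one →
           trans (relationOf-cong B≈ x y) (relationOf-matroidOf (proj₁ R) (proj₂ R) x y x≢one y≢one))
      , (λ {B} R≈ S → trans (matroidOf-cong R≈ S) (matroidOf-relationOf (proj₁ B) (proj₂ B) S))
    }

proposition3p9 : (n : ℕ) (G : FinGroup n) (H : Subset n) → IsSubgroup G H →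
    (m : ℕ) (Q : CosetSpace G H m) → 3 ≤ m →
    Inverse (MatroidSetoid Q) (RelationSetoid Q)
proposition3p9 _ _ _ subgroup _ Q _ = matroids↔relations subgroup Q
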